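{- Let $n\ge1$ and consider the $n\times n$ grid communication graph with a direction assignment in which adjacent circles have opposite directions. Then there are exactly $n$ rings, each of length $2n\pi$, and each ring hits each of the four walls exactly once.
   Context: Circles are pairwise disjoint unit circles in the plane. The $n\times m$ grid communication graph consists of $nm$ circles arranged in $n$ rows and $m$ columns, circles of a row horizontally aligned and circles of a column vertically aligned (centers on a square lattice), where circle $(i,j)$ is adjacent exactly to the existing circles among $(i\pm1,j)$ and $(i,j\pm1)$. For adjacent circles $C_i,C_j$, the link point of $C_i$ with respect to $C_j$ is the point of $C_i$ closest to $C_j$. A direction assignment gives each circle a direction ($1$ = counterclockwise, $-1$ = clockwise). A ring is a closed curve traced by a point that moves along the circles, on each circle in the direction assigned to that circle, and that, whenever it reaches a link point of its current circle $C_i$ with respect to an adjacent circle $C_j$, passes to $C_j$ at the corresponding link point of $C_j$ and continues there in the direction of $C_j$. The length of a ring is the total length of the circle arcs forming it. A ring hits the top wall at a circle of row $1$ if it passes through the topmost point of that circle; hitting the bottom wall (bottommost points of circles of the last row), the left wall (leftmost points of circles of column $1$) and the right wall (rightmost points of circles of the last column) are defined analogously. -}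

module Defs where

open import Data.Nat using (ℕ; zero; suc; _+_; _*_; _∸_; _<_; _≤_; _<?_)
open import Data.Fin using (Fin; toℕ; fromℕ<; inject₁) renaming (zero to fz; suc to fs)
open import Data.Fin.Properties using (toℕ<n)
open import Data.Product using (Σ; ∃; ∃-syntax; _×_; _,_)
open import Data.Maybe using (Maybe; just; nothing)
open import Relation.Binary.PropositionalEquality using (_≡_; _≢_)
open import Relation.Nullary using (yes; no)

-- Direction of a circle: counterclockwise (1) or clockwise (-1).
data Dir : Set where
  ccw cw : Dir

Pt : Set
Pt = Fin 4

E N W S : Pt
E = fz
N = fs fz
W = fs (fs fz)
S = fs (fs (fs fz))

rot+ : Fin 4 → Fin 4
rot+ fz = fs fz
rot+ (fs fz) = fs (fs fz)
rot+ (fs (fs fz)) = fs (fs (fs fz))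
rot+ (fs (fs (fs fz))) = fz

rot- : Fin 4 → Fin 4
rot- fz = fs (fs (fs fz))
rot- (fs fz) = fz
rot- (fs (fs fz)) = fs fz
rot- (fs (fs (fs fz))) = fs (fs fz)

opp : Pt → Pt
opp p = rot+ (rot+ p)

-- A circle of the n×n grid: (row, column); row 0 is the top row,
-- column 0 the leftmost column.
Circle : ℕ → Set
Circle n = Fin n × Fin n

-- A quarter arc of a circle: (circle, q) is the arc of that circle between
-- the cardinal points q and rot+ q (counterclockwise from q).
-- The link points of a circle lie among its cardinal points, so every ring
-- is a concatenation of such quarter arcs, each of length π/2.
Arc : ℕ → Set
Arc n = Fin n × Fin n × Fin 4

endPt : Dir → Fin 4 → Pt
endPt ccw q = rot+ q
endPt cw  q = q

arcFrom : Dir → Pt → Fin 4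
arcFrom ccw p = p
arcFrom cw  p = rot- p

predF : ∀ {n} → Fin n → Maybe (Fin n)
predF fz = nothing
predF (fs i) = just (inject₁ i)

sucF : ∀ {n} → Fin n → Maybe (Fin n)
sucF {n} i with suc (toℕ i) <? n
... | yes p = just (fromℕ< p)
... | no _  = nothing

-- The circle adjacent to circle (i , j) whose link point w.r.t. (i , j) ...
-- more precisely: neighbour n (i , j) p is the circle C' adjacent to (i , j)
-- such that p is the link point of (i , j) with respect to C' (if any).
neighbour : ∀ {n} → Circle n → Pt → Maybe (Circle n)
neighbour (i , j) fz with sucF j
... | just j' = just (i , j')
... | nothing = nothing
neighbour (i , j) (fs fz) with predF i
... | just i' = just (i' , j)
... | nothing = nothing
neighbour (i , j) (fs (fs fz)) with predF j
... | just j' = just (i , j')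
... | nothing = nothing
neighbour (i , j) (fs (fs (fs fz))) with sucF i
... | just i' = just (i' , j)
... | nothing = nothing

Adjacent : ∀ {n} → Circle n → Circle n → Set
Adjacent c c' = ∃[ p ] neighbour c p ≡ just c'

DirAssign : ℕ → Set
DirAssign n = Fin n → Fin n → Dir

-- Ring dynamics: after traversing a quarter arc, the moving point reaches a
-- cardinal point p of its circle; if p is a link point w.r.t. an adjacent
-- circle C', it passes to C' at the corresponding (opposite) link point and
-- continues in the direction of C'; otherwise it continues on the same circle.
next : ∀ {n} → DirAssign n → Arc n → Arc n
next d (i , j , q) with endPt (d i j) q
... | p with neighbour (i , j) p
...   | just (i' , j') = i' , j' , arcFrom (d i' j') (opp p)
...   | nothing        = i , j , arcFrom (d i j) p

iter : ∀ {A : Set} → (A → A) → ℕ → A → A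
iter f zero x = x
iter f (suc k) x = f (iter f k x)

SameRing : ∀ {n} → DirAssign n → Arc n → Arc n → Set
SameRing d a b = ∃[ k ] iter (next d) k a ≡ b

-- The ring through a consists of exactly m quarter arcs, i.e. has length m·π/2.
RingArcCount : ∀ {n} → DirAssign n → Arc n → ℕ → Set
RingArcCount d a m =
  (0 < m) × (iter (next d) m a ≡ a) × (∀ k → 0 < k → k < m → iter (next d) k a ≢ a)

PassesThrough : ∀ {n} → DirAssign n → Arc n → Fin n → Fin n → Pt → Set
PassesThrough d a i j p =
  ∃[ q ] (SameRing d a (i , j , q) × endPt (d i j) q ≡ p)

HitsTop HitsBottom HitsLeft HitsRight : ∀ {n} → DirAssign n → Arc n → Fin n → Set
HitsTop    {n} d a j = Σ (Fin n) λ i → toℕ i ≡ 0       × PassesThrough d a i j N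
HitsBottom {n} d a j = Σ (Fin n) λ i → toℕ i ≡ n ∸ 1   × PassesThrough d a i j S
HitsLeft   {n} d a i = Σ (Fin n) λ j → toℕ j ≡ 0       × PassesThrough d a i j W
HitsRight  {n} d a i = Σ (Fin n) λ j → toℕ j ≡ n ∸ 1   × PassesThrough d a i j E

ExactlyOne : ∀ {n} → (Fin n → Set) → Set
ExactlyOne {n} P = (∃[ k ] P k) × (∀ k k' → P k → P k' → k ≡ k')

NumRings : ∀ {n} → DirAssign n → ℕ → Set
NumRings {n} d m =
  Σ (Fin m → Arc n) λ rep →
    (∀ a → ∃[ r ] SameRing d (rep r) a) ×
    (∀ r r' → SameRing d (rep r) (rep r') → r ≡ r')

-- Each quarter arc carries two phases in ℤ/4n.  Horizontally, the moving point lies in one of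
-- the 2n half-columns of the grid and heads left or right; since adjacent circles turn in
-- opposite directions, every quarter arc either moves it one half-column further in its heading
-- or, at the outer walls, reverses the heading in place.  So it bounces in [0, 2n), and unfolding
-- the bounce onto a cycle of length 4n makes the horizontal phase advance by exactly 1 per
-- quarter arc; the same holds vertically.  The two phases determine the arc, so every ring
-- consists of 4n quarter arcs (length 2nπ); each wall corresponds to a single value of one
-- phase, so every ring hits every wall exactly once; and the 4n² arcs form n rings, one through
-- the top of each circle of the first row.
module Submission where

open import Data.Bool using (Bool; true; false; not)
open import Data.Fin using (Fin; toℕ) renaming (zero to fz; suc to fs)
open import Data.Fin.Properties using (toℕ<n; toℕ-fromℕ<; toℕ-inject₁; toℕ-injective)
open import Data.Maybe using (Maybe; just; nothing)
open import Data.Nat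
open import Data.Nat.DivMod
open import Data.Nat.Properties
open import Data.Product
open import Data.Product.Properties using (,-injective)
open import Data.Product.Function.NonDependent.Propositional using (_×-⇔_)
open import Function.Bundles using (_⇔_; mk⇔; Equivalence)
import Function.Properties.Equivalence as ⇔
open import Relation.Binary.PropositionalEquality
open import Relation.Nullary using (yes; no; contradiction)

open import Defs

iter-+ : ∀ {X : Set} (f : X → X) k l x → iter f (k + l) x ≡ iter f k (iter f l x)
iter-+ f zero    l x = refl
iter-+ f (suc k) l x = cong f (iter-+ f k l x)

module _ (M : ℕ) .{{_ : NonZero M}} where

  [1+m%n]%n≡[1+m]%n : ∀ a → suc (a % M) % M ≡ suc a % M
  [1+m%n]%n≡[1+m]%n a = begin
    suc (a % M) % M              ≡⟨ [m+kn]%n≡m%n (suc (a % M)) (a / M) M ⟨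
    suc (a % M + a / M * M) % M  ≡⟨ cong (λ t → suc t % M) (m≡m%n+[m/n]*n a M) ⟨
    suc a % M                    ∎
    where open ≡-Reasoning

  %-translate : ∀ a c k l → a ≤ M → (a + k) % M ≡ (a + l) % M → (c + k) % M ≡ (c + l) % M
  %-translate a c k l a≤M a+k≡a+l = begin
    (c + k) % M                                  ≡⟨ [m+n]%n≡m%n (c + k) M ⟨
    (c + k + M) % M                              ≡⟨ cong (_% M) (regroup k) ⟨
    ((M ∸ a + c) + (a + k)) % M                  ≡⟨ %-distribˡ-+ (M ∸ a + c) (a + k) M ⟩
    ((M ∸ a + c) % M + (a + k) % M) % M          ≡⟨ cong (λ t → ((M ∸ a + c) % M + t) % M) a+k≡a+l ⟩
    ((M ∸ a + c) % M + (a + l) % M) % M          ≡⟨ %-distribˡ-+ (M ∸ a + c) (a + l) M ⟨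
    ((M ∸ a + c) + (a + l)) % M                  ≡⟨ cong (_% M) (regroup l) ⟩
    (c + l + M) % M                              ≡⟨ [m+n]%n≡m%n (c + l) M ⟩
    (c + l) % M                                  ∎
    where
    open ≡-Reasoning
    regroup : ∀ t → (M ∸ a + c) + (a + t) ≡ c + t + M
    regroup t = begin
      (M ∸ a + c) + (a + t)  ≡⟨ cong (_+ (a + t)) (+-comm (M ∸ a) c) ⟩
      (c + (M ∸ a)) + (a + t) ≡⟨ +-assoc c (M ∸ a) (a + t) ⟩
      c + ((M ∸ a) + (a + t)) ≡⟨ cong (c +_) (+-assoc (M ∸ a) a t) ⟨
      c + ((M ∸ a + a) + t)   ≡⟨ cong (λ s → c + (s + t)) (m∸n+n≡m a≤M) ⟩
      c + (M + t)             ≡⟨ cong (c +_) (+-comm M t) ⟩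
      c + (t + M)             ≡⟨ +-assoc c t M ⟨
      c + t + M               ∎

module Clocks {X : Set} (f : X → X) (M : ℕ) .{{_ : NonZero M}} where

  Reaches : X → X → Set
  Reaches x y = ∃[ k ] iter f k x ≡ y

  record IsClock (V : X → ℕ) : Set where
    field
      bounded : ∀ x → V x < M
      ticks   : ∀ x → V (f x) ≡ suc (V x) % M

  open IsClock

  module _ {V : X → ℕ} (clock : IsClock V) where

    clock-iter : ∀ k x → V (iter f k x) ≡ (V x + k) % M
    clock-iter zero x = begin
      V x            ≡⟨ m<n⇒m%n≡m (bounded clock x) ⟨
      V x % M        ≡⟨ cong (_% M) (+-identityʳ (V x)) ⟨
      (V x + 0) % M  ∎
      where open ≡-Reasoning
    clock-iter (suc k) x = begin
      V (f (iter f k x))       ≡⟨ ticks clock _ ⟩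
      suc (V (iter f k x)) % M ≡⟨ cong (λ t → suc t % M) (clock-iter k x) ⟩
      suc ((V x + k) % M) % M  ≡⟨ [1+m%n]%n≡[1+m]%n M (V x + k) ⟩
      suc (V x + k) % M        ≡⟨ cong (_% M) (+-suc (V x) k) ⟨
      (V x + suc k) % M        ∎
      where open ≡-Reasoning

    clock-reaches : ∀ x c → c < M → ∃[ k ] V (iter f k x) ≡ c
    clock-reaches x c c<M = M ∸ V x + c , (begin
      V (iter f (M ∸ V x + c) x)  ≡⟨ clock-iter _ x ⟩
      (V x + (M ∸ V x + c)) % M   ≡⟨ cong (_% M) (+-assoc (V x) (M ∸ V x) c) ⟨
      (V x + (M ∸ V x) + c) % M   ≡⟨ cong (λ t → (t + c) % M) (m+[n∸m]≡n (<⇒≤ (bounded clock x))) ⟩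
      (M + c) % M                 ≡⟨ cong (_% M) (+-comm M c) ⟩
      (c + M) % M                 ≡⟨ [m+n]%n≡m%n c M ⟩
      c % M                       ≡⟨ m<n⇒m%n≡m c<M ⟩
      c                           ∎)
      where open ≡-Reasoning

    iter-aperiodic : ∀ x k → 0 < k → k < M → iter f k x ≢ x
    iter-aperiodic x k 0<k k<M loop = <⇒≢ 0<k (sym k≡0)
      where
      open ≡-Reasoning
      same-reading : (V x + k) % M ≡ (V x + 0) % M
      same-reading = trans (sym (clock-iter k x)) (trans (cong V loop) (clock-iter 0 x))
      k≡0 : k ≡ 0
      k≡0 = begin
        k            ≡⟨ m<n⇒m%n≡m k<M ⟨
        (0 + k) % M  ≡⟨ %-translate M (V x) 0 k 0 (<⇒≤ (bounded clock x)) same-reading ⟩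
        (0 + 0) % M  ≡⟨ m<n⇒m%n≡m (>-nonZero⁻¹ M) ⟩
        0            ∎

  clock-sync : ∀ {V W} → IsClock V → IsClock W → ∀ x k l →
               V (iter f k x) ≡ V (iter f l x) → W (iter f k x) ≡ W (iter f l x)
  clock-sync {V} {W} clockV clockW x k l Vk≡Vl = begin
    W (iter f k x)   ≡⟨ clock-iter clockW k x ⟩
    (W x + k) % M    ≡⟨ %-translate M (V x) (W x) k l (<⇒≤ (bounded clockV x)) V-readings ⟩
    (W x + l) % M    ≡⟨ clock-iter clockW l x ⟨
    W (iter f l x)   ∎
    where
    open ≡-Reasoning
    V-readings : (V x + k) % M ≡ (V x + l) % M
    V-readings = trans (sym (clock-iter clockV k x)) (trans Vk≡Vl (clock-iter clockV l x))

  module Orbits {A B : X → ℕ} (clockA : IsClock A) (clockB : IsClock B)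
           (A×B-injective : ∀ x y → A x ≡ A y → B x ≡ B y → x ≡ y) where

    iter-period : ∀ x → iter f M x ≡ x
    iter-period x = A×B-injective _ _ (full-turn clockA) (full-turn clockB)
      where
      full-turn : ∀ {V} → IsClock V → V (iter f M x) ≡ V x
      full-turn {V} clock =
        trans (clock-iter clock M x) (trans ([m+n]%n≡m%n (V x) M) (m<n⇒m%n≡m (bounded clock x)))

    reaches-injective : ∀ {V} → IsClock V → ∀ {x y z} →
                        Reaches x y → Reaches x z → V y ≡ V z → y ≡ z
    reaches-injective clock (k , refl) (l , refl) Vy≡Vz =
      A×B-injective _ _ (clock-sync clock clockA _ k l Vy≡Vz) (clock-sync clock clockB _ k l Vy≡Vz)

    reaches-sym : ∀ {x y} → Reaches x y → Reaches y x
    reaches-sym {x} (k , refl) with clock-reaches clockA (iter f k x) (A x) (bounded clockA x)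
    ... | l , Al≡Ax = l , (begin
      iter f l (iter f k x)  ≡⟨ iter-+ f l k x ⟨
      iter f (l + k) x       ≡⟨ reaches-injective clockA (l + k , refl) (0 , refl)
                                  (trans (cong A (iter-+ f l k x)) Al≡Ax) ⟩
      x                      ∎)
      where open ≡-Reasoning

    exactlyOne-by-clock : ∀ {V} → IsClock V → ∀ {n x c} (π : X → Fin n) (P : Fin n → Set) →
      c < M → (∀ k → P k ⇔ (∃[ y ] Reaches x y × V y ≡ c × π y ≡ k)) → ExactlyOne P
    exactlyOne-by-clock clock {x = x} {c} π P c<M P⇔ = existence , uniqueness
      where
      existence : ∃[ k ] P k
      existence with clock-reaches clock x c c<M
      ... | k , Vk≡c = _ , Equivalence.from (P⇔ _) (iter f k x , (k , refl) , Vk≡c , refl)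
      uniqueness : ∀ k k' → P k → P k' → k ≡ k'
      uniqueness k k' Pk Pk' with Equivalence.to (P⇔ k) Pk | Equivalence.to (P⇔ k') Pk'
      ... | y , x↝y , Vy≡c , refl | y' , x↝y' , Vy'≡c , refl =
        cong π (reaches-injective clock x↝y x↝y' (trans Vy≡c (sym Vy'≡c)))

-- A point bouncing back and forth in [0, L): heading true means increasing.
-- Unfolding the two legs of the motion onto [0, 2L) turns it into a uniform rotation.
module Bouncing (L : ℕ) .{{_ : NonZero L}} where

  period : ℕ
  period = L + L

  private instance
    period-nonZero : NonZero period
    period-nonZero = >-nonZero (<-≤-trans (>-nonZero⁻¹ L) (m≤m+n L L))

  data Bounce : ℕ × Bool → ℕ × Bool → Set where
    advance       : ∀ {u u'} → suc u ≡ u' → u' < L → Bounce (u , true) (u' , true)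
    turn-at-end   : ∀ {u u'} → suc u ≡ L → u ≡ u' → Bounce (u , true) (u' , false)
    retreat       : ∀ {u u'} → suc u' ≡ u → Bounce (u , false) (u' , false)
    turn-at-start : ∀ {u u'} → u ≡ 0 → u' ≡ 0 → Bounce (u , false) (u' , true)

  phase : ℕ × Bool → ℕ
  phase (u , true)  = u
  phase (u , false) = period ∸ suc u

  L<period : L < period
  L<period = m<m+n L (>-nonZero⁻¹ L)

  period∸suc<period : ∀ u → period ∸ suc u < period
  period∸suc<period u = ∸-suc-< period (>-nonZero⁻¹ period)
    where
    ∸-suc-< : ∀ m → 0 < m → m ∸ suc u < m
    ∸-suc-< (suc m) _ = s≤s (m∸n≤m m u)

  phase-< : ∀ s → proj₁ s < L → phase s < period
  phase-< (u , true)  u<L = <-trans u<L L<period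
  phase-< (u , false) _   = period∸suc<period u

  phase-injective : ∀ s s' → proj₁ s < L → proj₁ s' < L → phase s ≡ phase s' → s ≡ s'
  phase-injective (u , true)  (u' , true)  _   _    u≡u' = cong (_, true) u≡u'
  phase-injective (u , false) (u' , false) u<L u'<L e =
    cong (_, false) (suc-injective (∸-cancelˡ-≡ (<-trans u<L L<period) (<-trans u'<L L<period) e))
  phase-injective (u , true)  (u' , false) u<L u'<L e = contradiction e (legs-disjoint u<L u'<L)
    where
    legs-disjoint : ∀ {u u'} → u < L → u' < L → u ≢ period ∸ suc u'
    legs-disjoint {u} {u'} u<L u'<L e = <-irrefl e (<-≤-trans u<L (begin
      L                  ≡⟨ m+n∸m≡n L L ⟨
      period ∸ L         ≤⟨ ∸-monoʳ-≤ period u'<L ⟩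
      period ∸ suc u'    ∎))
      where open ≤-Reasoning
  phase-injective (u , false) (u' , true)  u<L u'<L e = sym (phase-injective _ _ u'<L u<L (sym e))

  bounce-phase : ∀ {s s'} → proj₁ s < L → Bounce s s' → phase s' ≡ suc (phase s) % period
  bounce-phase _ (advance refl u'<L) = sym (m<n⇒m%n≡m (<-trans u'<L L<period))
  bounce-phase _ (turn-at-end {u} end refl) = begin
    period ∸ suc u      ≡⟨ cong (period ∸_) end ⟩
    period ∸ L          ≡⟨ m+n∸m≡n L L ⟩
    L                   ≡⟨ m<n⇒m%n≡m L<period ⟨
    L % period          ≡⟨ cong (_% period) end ⟨
    suc u % period      ∎
    where open ≡-Reasoning
  bounce-phase u<L (retreat {u' = u'} refl) = begin
    period ∸ suc u'                    ≡⟨ m<n⇒m%n≡m (period∸suc<period u') ⟨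
    (period ∸ suc u') % period         ≡⟨ cong (_% period) (+-∸-assoc 1 (<-trans u<L L<period)) ⟩
    suc (period ∸ suc (suc u')) % period ∎
    where open ≡-Reasoning
  bounce-phase _ (turn-at-start refl refl) = begin
    0                          ≡⟨ n%n≡0 period ⟨
    period % period            ≡⟨ cong (_% period) (suc-pred period) ⟨
    suc (period ∸ 1) % period  ∎
    where open ≡-Reasoning

sucF-just : ∀ {n} {j j' : Fin n} → sucF j ≡ just j' → toℕ j' ≡ suc (toℕ j)
sucF-just {n} {j} e with suc (toℕ j) <? n
sucF-just refl | yes j+1<n = toℕ-fromℕ< j+1<n

sucF-nothing : ∀ {n} {j : Fin n} → sucF j ≡ nothing → suc (toℕ j) ≡ n
sucF-nothing {n} {j} e with suc (toℕ j) <? n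
... | no j+1≮n = ≤-antisym (toℕ<n j) (≮⇒≥ j+1≮n)

neighbour-N : ∀ {n} (i j : Fin n) {i' j'} → neighbour (i , j) N ≡ just (i' , j') →
              j' ≡ j × toℕ i ≡ suc (toℕ i')
neighbour-N (fs i) j refl = refl , cong suc (sym (toℕ-inject₁ i))

neighbour-N-none : ∀ {n} (i j : Fin n) → neighbour (i , j) N ≡ nothing → toℕ i ≡ 0
neighbour-N-none fz j _ = refl

neighbour-W : ∀ {n} (i j : Fin n) {i' j'} → neighbour (i , j) W ≡ just (i' , j') →
              i' ≡ i × toℕ j ≡ suc (toℕ j')
neighbour-W i (fs j) refl = refl , cong suc (sym (toℕ-inject₁ j))

neighbour-W-none : ∀ {n} (i j : Fin n) → neighbour (i , j) W ≡ nothing → toℕ j ≡ 0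
neighbour-W-none i fz _ = refl

neighbour-E : ∀ {n} (i j : Fin n) {i' j'} → neighbour (i , j) E ≡ just (i' , j') →
              i' ≡ i × toℕ j' ≡ suc (toℕ j)
neighbour-E i j e with sucF j in sucF≡
neighbour-E i j refl | just j' = refl , sucF-just sucF≡

neighbour-E-none : ∀ {n} (i j : Fin n) → neighbour (i , j) E ≡ nothing → suc (toℕ j) ≡ n
neighbour-E-none i j e with sucF j in sucF≡
neighbour-E-none i j e | nothing = sucF-nothing sucF≡

neighbour-S : ∀ {n} (i j : Fin n) {i' j'} → neighbour (i , j) S ≡ just (i' , j') →
              j' ≡ j × toℕ i' ≡ suc (toℕ i)
neighbour-S i j e with sucF i in sucF≡
neighbour-S i j refl | just i' = refl , sucF-just sucF≡

neighbour-S-none : ∀ {n} (i j : Fin n) → neighbour (i , j) S ≡ nothing → suc (toℕ i) ≡ n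
neighbour-S-none i j e with sucF i in sucF≡
neighbour-S-none i j e | nothing = sucF-nothing sucF≡

double : ℕ → ℕ
double zero    = zero
double (suc k) = suc (suc (double k))

-- The halves of circle k occupy the half-unit intervals 2k (left/upper) and 2k+1 (right/lower).
halfIndex : Bool → ℕ → ℕ
halfIndex false k = double k
halfIndex true  k = suc (double k)

double≡2* : ∀ k → double k ≡ 2 * k
double≡2* zero    = refl
double≡2* (suc k) = trans (cong (2 +_) (double≡2* k)) (sym (*-distribˡ-+ 2 1 k))

double-injective : ∀ {k k'} → double k ≡ double k' → k ≡ k'
double-injective {zero}  {zero}   _ = refl
double-injective {suc k} {suc k'} e = cong suc (double-injective (suc-injective (suc-injective e)))

double≢suc-double : ∀ k k' → double k ≢ suc (double k')
double≢suc-double (suc k) (suc k') e = double≢suc-double k k' (suc-injective (suc-injective e))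

halfIndex-injective : ∀ {b b' k k'} → halfIndex b k ≡ halfIndex b' k' → b ≡ b' × k ≡ k'
halfIndex-injective {false} {false}         e = refl , double-injective e
halfIndex-injective {true}  {true}          e = refl , double-injective (suc-injective e)
halfIndex-injective {false} {true}  {k} {k'} e = contradiction e (double≢suc-double k k')
halfIndex-injective {true}  {false} {k} {k'} e = contradiction (sym e) (double≢suc-double k' k)

suc-double-< : ∀ {k n} → k < n → suc (double k) < double n
suc-double-< {zero}  {suc n} _         = s≤s (s≤s z≤n)
suc-double-< {suc k} {suc n} (s≤s k<n) = s≤s (s≤s (suc-double-< k<n))

halfIndex-< : ∀ b {k n} → k < n → halfIndex b k < double n
halfIndex-< true  k<n = suc-double-< k<n
halfIndex-< false k<n = <-trans (n<1+n _) (suc-double-< k<n)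

halfIndex-pair-≡⇔ : ∀ {h t b : Bool} {x k} →
  (halfIndex h x , t) ≡ (halfIndex b k , b) ⇔ (x ≡ k × (h , t) ≡ (b , b))
halfIndex-pair-≡⇔ {h} {t} {b} {x} {k} = mk⇔ to from
  where
  to : (halfIndex h x , t) ≡ (halfIndex b k , b) → x ≡ k × (h , t) ≡ (b , b)
  to e with ,-injective e
  ... | hx≡bk , refl with halfIndex-injective {h} {b} {x} {k} hx≡bk
  ...   | refl , refl = refl , refl
  from : x ≡ k × (h , t) ≡ (b , b) → (halfIndex h x , t) ≡ (halfIndex b k , b)
  from (refl , refl) = refl

rightHalf lowerHalf : Fin 4 → Bool
rightHalf fz                = true
rightHalf (fs fz)           = false
rightHalf (fs (fs fz))      = false
rightHalf (fs (fs (fs fz))) = true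
lowerHalf fz                = false
lowerHalf (fs fz)           = false
lowerHalf (fs (fs fz))      = true
lowerHalf (fs (fs (fs fz))) = true

quadrant : Bool → Bool → Fin 4
quadrant true  false = fz
quadrant false false = fs fz
quadrant false true  = fs (fs fz)
quadrant true  true  = fs (fs (fs fz))

quadrant-halves : ∀ q → quadrant (rightHalf q) (lowerHalf q) ≡ q
quadrant-halves fz                = refl
quadrant-halves (fs fz)           = refl
quadrant-halves (fs (fs fz))      = refl
quadrant-halves (fs (fs (fs fz))) = refl

-- Rows are numbered from the top, so `downward` is the direction of increasing row index.
rightward downward : Dir → Fin 4 → Bool
rightward ccw q = lowerHalf q
rightward cw  q = not (lowerHalf q)
downward  ccw q = not (rightHalf q)
downward  cw  q = rightHalf q

vExtreme hExtreme : Bool → Pt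
vExtreme false = N
vExtreme true  = S
hExtreme false = W
hExtreme true  = E

private
  refl⇔refl : ∀ {A B : Set} {a : A} {b : B} → (a ≡ a) ⇔ (b ≡ b)
  refl⇔refl = mk⇔ (λ _ → refl) (λ _ → refl)

endPt≡vExtreme⇔ : ∀ c q b → endPt c q ≡ vExtreme b ⇔ (lowerHalf q , downward c q) ≡ (b , b)
endPt≡vExtreme⇔ ccw fz                false = refl⇔refl
endPt≡vExtreme⇔ ccw fz                true  = mk⇔ (λ ()) (λ ())
endPt≡vExtreme⇔ ccw (fs fz)           false = mk⇔ (λ ()) (λ ())
endPt≡vExtreme⇔ ccw (fs fz)           true  = mk⇔ (λ ()) (λ ())
endPt≡vExtreme⇔ ccw (fs (fs fz))      false = mk⇔ (λ ()) (λ ())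
endPt≡vExtreme⇔ ccw (fs (fs fz))      true  = refl⇔refl
endPt≡vExtreme⇔ ccw (fs (fs (fs fz))) false = mk⇔ (λ ()) (λ ())
endPt≡vExtreme⇔ ccw (fs (fs (fs fz))) true  = mk⇔ (λ ()) (λ ())
endPt≡vExtreme⇔ cw  fz                false = mk⇔ (λ ()) (λ ())
endPt≡vExtreme⇔ cw  fz                true  = mk⇔ (λ ()) (λ ())
endPt≡vExtreme⇔ cw  (fs fz)           false = refl⇔refl
endPt≡vExtreme⇔ cw  (fs fz)           true  = mk⇔ (λ ()) (λ ())
endPt≡vExtreme⇔ cw  (fs (fs fz))      false = mk⇔ (λ ()) (λ ())
endPt≡vExtreme⇔ cw  (fs (fs fz))      true  = mk⇔ (λ ()) (λ ())
endPt≡vExtreme⇔ cw  (fs (fs (fs fz))) false = mk⇔ (λ ()) (λ ())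
endPt≡vExtreme⇔ cw  (fs (fs (fs fz))) true  = refl⇔refl

endPt≡hExtreme⇔ : ∀ c q b → endPt c q ≡ hExtreme b ⇔ (rightHalf q , rightward c q) ≡ (b , b)
endPt≡hExtreme⇔ ccw fz                false = mk⇔ (λ ()) (λ ())
endPt≡hExtreme⇔ ccw fz                true  = mk⇔ (λ ()) (λ ())
endPt≡hExtreme⇔ ccw (fs fz)           false = refl⇔refl
endPt≡hExtreme⇔ ccw (fs fz)           true  = mk⇔ (λ ()) (λ ())
endPt≡hExtreme⇔ ccw (fs (fs fz))      false = mk⇔ (λ ()) (λ ())
endPt≡hExtreme⇔ ccw (fs (fs fz))      true  = mk⇔ (λ ()) (λ ())
endPt≡hExtreme⇔ ccw (fs (fs (fs fz))) false = mk⇔ (λ ()) (λ ())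
endPt≡hExtreme⇔ ccw (fs (fs (fs fz))) true  = refl⇔refl
endPt≡hExtreme⇔ cw  fz                false = mk⇔ (λ ()) (λ ())
endPt≡hExtreme⇔ cw  fz                true  = refl⇔refl
endPt≡hExtreme⇔ cw  (fs fz)           false = mk⇔ (λ ()) (λ ())
endPt≡hExtreme⇔ cw  (fs fz)           true  = mk⇔ (λ ()) (λ ())
endPt≡hExtreme⇔ cw  (fs (fs fz))      false = refl⇔refl
endPt≡hExtreme⇔ cw  (fs (fs fz))      true  = mk⇔ (λ ()) (λ ())
endPt≡hExtreme⇔ cw  (fs (fs (fs fz))) false = mk⇔ (λ ()) (λ ())
endPt≡hExtreme⇔ cw  (fs (fs (fs fz))) true  = mk⇔ (λ ()) (λ ())

arcTo : Dir → Pt → Fin 4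
arcTo ccw p = rot- p
arcTo cw  p = p

arcTo-endPt : ∀ c q → arcTo c (endPt c q) ≡ q
arcTo-endPt ccw fz                = refl
arcTo-endPt ccw (fs fz)           = refl
arcTo-endPt ccw (fs (fs fz))      = refl
arcTo-endPt ccw (fs (fs (fs fz))) = refl
arcTo-endPt cw  q                 = refl

endPt-arcTo : ∀ c p → endPt c (arcTo c p) ≡ p
endPt-arcTo ccw fz                = refl
endPt-arcTo ccw (fs fz)           = refl
endPt-arcTo ccw (fs (fs fz))      = refl
endPt-arcTo ccw (fs (fs (fs fz))) = refl
endPt-arcTo cw  p                 = refl

flipDir : Dir → Dir
flipDir ccw = cw
flipDir cw  = ccw

leave : ∀ {n} → DirAssign n → Fin n → Fin n → Pt → Maybe (Circle n) → Arc n
leave d i j p (just (i' , j')) = i' , j' , arcFrom (d i' j') (opp p)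
leave d i j p nothing          = i , j , arcFrom (d i j) p

next≡leave : ∀ {n} (d : DirAssign n) i j q →
  next d (i , j , q) ≡ leave d i j (endPt (d i j) q) (neighbour (i , j) (endPt (d i j) q))
next≡leave d i j q with endPt (d i j) q
... | p with neighbour (i , j) p
...   | just (i' , j') = refl
...   | nothing        = refl

module Grid (m : ℕ) (d : DirAssign (suc m))
  (proper : ∀ i j i' j' → Adjacent (i , j) (i' , j') → d i j ≢ d i' j') where

  n : ℕ
  n = suc m

  open Bouncing (double n)

  hState vState : Arc n → ℕ × Bool
  hState (i , j , q) = halfIndex (rightHalf q) (toℕ j) , rightward (d i j) q
  vState (i , j , q) = halfIndex (lowerHalf q) (toℕ i) , downward  (d i j) q

  hState-< : ∀ a → proj₁ (hState a) < double n
  hState-< (i , j , q) = halfIndex-< (rightHalf q) (toℕ<n j)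

  vState-< : ∀ a → proj₁ (vState a) < double n
  vState-< (i , j , q) = halfIndex-< (lowerHalf q) (toℕ<n i)

  neighbour-flips : ∀ {i j i' j' p c} → d i j ≡ c → neighbour (i , j) p ≡ just (i' , j') →
                    d i' j' ≡ flipDir c
  neighbour-flips {i} {j} {i'} {j'} {p} {c} dij≡c adj with d i' j' in di'j'≡ | c
  ... | ccw | ccw = contradiction (trans dij≡c (sym di'j'≡)) (proper i j i' j' (p , adj))
  ... | ccw | cw  = refl
  ... | cw  | ccw = refl
  ... | cw  | cw  = contradiction (trans dij≡c (sym di'j'≡)) (proper i j i' j' (p , adj))

  retreat-within : ∀ {x x'} → x' ≡ x → Bounce (halfIndex true x , false) (halfIndex false x' , false)
  retreat-within refl = retreat refl

  retreat-across : ∀ {x x'} → x ≡ suc x' → Bounce (halfIndex false x , false) (halfIndex true x' , false)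
  retreat-across refl = retreat refl

  advance-within : ∀ {x x'} → x' ≡ x → x < n → Bounce (halfIndex false x , true) (halfIndex true x' , true)
  advance-within refl x<n = advance refl (halfIndex-< true x<n)

  advance-across : ∀ {x x'} → x' ≡ suc x → x' < n → Bounce (halfIndex true x , true) (halfIndex false x' , true)
  advance-across refl x'<n = advance refl (halfIndex-< false x'<n)

  turn-at-first : ∀ {x x'} → x ≡ 0 → x' ≡ 0 → Bounce (halfIndex false x , false) (halfIndex false x' , true)
  turn-at-first refl refl = turn-at-start refl refl

  turn-at-last : ∀ {x x'} → suc x ≡ n → x' ≡ x → Bounce (halfIndex true x , true) (halfIndex true x' , false)
  turn-at-last refl refl = turn-at-end refl refl

  BounceStep : Arc n → Arc n → Set
  BounceStep a b = Bounce (hState a) (hState b) × Bounce (vState a) (vState b)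

  next-bounces : ∀ i j q → BounceStep (i , j , q) (next d (i , j , q))
  next-bounces i j q rewrite next≡leave d i j q with d i j in dij≡ | q
  ... | ccw | fz with neighbour (i , j) N in adj
  ...   | just _ rewrite neighbour-flips {p = N} dij≡ adj =
            retreat-within (cong toℕ (proj₁ (neighbour-N i j adj))) , retreat-across (proj₂ (neighbour-N i j adj))
  ...   | nothing rewrite dij≡ =
            retreat-within refl , turn-at-first (neighbour-N-none i j adj) (neighbour-N-none i j adj)
  next-bounces i j q | ccw | fs fz with neighbour (i , j) W in adj
  ...   | just _ rewrite neighbour-flips {p = W} dij≡ adj =
            retreat-across (proj₂ (neighbour-W i j adj)) , advance-within (cong toℕ (proj₁ (neighbour-W i j adj))) (toℕ<n i)
  ...   | nothing rewrite dij≡ =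
            turn-at-first (neighbour-W-none i j adj) (neighbour-W-none i j adj) , advance-within refl (toℕ<n i)
  next-bounces i j q | ccw | fs (fs fz) with neighbour (i , j) S in adj
  ...   | just (i' , _) rewrite neighbour-flips {p = S} dij≡ adj =
            advance-within (cong toℕ (proj₁ (neighbour-S i j adj))) (toℕ<n j) , advance-across (proj₂ (neighbour-S i j adj)) (toℕ<n i')
  ...   | nothing rewrite dij≡ =
            advance-within refl (toℕ<n j) , turn-at-last (neighbour-S-none i j adj) refl
  next-bounces i j q | ccw | fs (fs (fs fz)) with neighbour (i , j) E in adj
  ...   | just (_ , j') rewrite neighbour-flips {p = E} dij≡ adj =
            advance-across (proj₂ (neighbour-E i j adj)) (toℕ<n j') , retreat-within (cong toℕ (proj₁ (neighbour-E i j adj)))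
  ...   | nothing rewrite dij≡ =
            turn-at-last (neighbour-E-none i j adj) refl , retreat-within refl
  next-bounces i j q | cw | fz with neighbour (i , j) E in adj
  ...   | just (_ , j') rewrite neighbour-flips {p = E} dij≡ adj =
            advance-across (proj₂ (neighbour-E i j adj)) (toℕ<n j') , advance-within (cong toℕ (proj₁ (neighbour-E i j adj))) (toℕ<n i)
  ...   | nothing rewrite dij≡ =
            turn-at-last (neighbour-E-none i j adj) refl , advance-within refl (toℕ<n i)
  next-bounces i j q | cw | fs fz with neighbour (i , j) N in adj
  ...   | just _ rewrite neighbour-flips {p = N} dij≡ adj =
            advance-within (cong toℕ (proj₁ (neighbour-N i j adj))) (toℕ<n j) , retreat-across (proj₂ (neighbour-N i j adj))
  ...   | nothing rewrite dij≡ =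
            advance-within refl (toℕ<n j) , turn-at-first (neighbour-N-none i j adj) (neighbour-N-none i j adj)
  next-bounces i j q | cw | fs (fs fz) with neighbour (i , j) W in adj
  ...   | just _ rewrite neighbour-flips {p = W} dij≡ adj =
            retreat-across (proj₂ (neighbour-W i j adj)) , retreat-within (cong toℕ (proj₁ (neighbour-W i j adj)))
  ...   | nothing rewrite dij≡ =
            turn-at-first (neighbour-W-none i j adj) (neighbour-W-none i j adj) , retreat-within refl
  next-bounces i j q | cw | fs (fs (fs fz)) with neighbour (i , j) S in adj
  ...   | just (i' , _) rewrite neighbour-flips {p = S} dij≡ adj =
            retreat-within (cong toℕ (proj₁ (neighbour-S i j adj))) , advance-across (proj₂ (neighbour-S i j adj)) (toℕ<n i')
  ...   | nothing rewrite dij≡ =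
            retreat-within refl , turn-at-last (neighbour-S-none i j adj) refl

  xPhase yPhase : Arc n → ℕ
  xPhase a = phase (hState a)
  yPhase a = phase (vState a)

  open Clocks (next d) period

  xClock : IsClock xPhase
  xClock = record
    { bounded = λ a → phase-< (hState a) (hState-< a)
    ; ticks   = λ { a@(i , j , q) → bounce-phase {hState a} (hState-< a) (proj₁ (next-bounces i j q)) }
    }

  yClock : IsClock yPhase
  yClock = record
    { bounded = λ a → phase-< (vState a) (vState-< a)
    ; ticks   = λ { a@(i , j , q) → bounce-phase {vState a} (vState-< a) (proj₂ (next-bounces i j q)) }
    }

  states-injective : ∀ a b → hState a ≡ hState b → vState a ≡ vState b → a ≡ b
  states-injective (i , j , q) (i' , j' , q') h≡h' v≡v'
    with halfIndex-injective {rightHalf q} {rightHalf q'} (cong proj₁ h≡h')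
       | halfIndex-injective {lowerHalf q} {lowerHalf q'} (cong proj₁ v≡v')
  ... | r≡r' , j≡j' | l≡l' , i≡i' =
    cong₂ _,_ (toℕ-injective i≡i') (cong₂ _,_ (toℕ-injective j≡j') (begin
      q                                      ≡⟨ quadrant-halves q ⟨
      quadrant (rightHalf q) (lowerHalf q)   ≡⟨ cong₂ quadrant r≡r' l≡l' ⟩
      quadrant (rightHalf q') (lowerHalf q') ≡⟨ quadrant-halves q' ⟩
      q'                                     ∎))
    where open ≡-Reasoning

  phases-injective : ∀ a b → xPhase a ≡ xPhase b → yPhase a ≡ yPhase b → a ≡ b
  phases-injective a b xa≡xb ya≡yb = states-injective a b
    (phase-injective (hState a) (hState b) (hState-< a) (hState-< b) xa≡xb)
    (phase-injective (vState a) (vState b) (vState-< a) (vState-< b) ya≡yb)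

  open Orbits xClock yClock phases-injective

  -- Index of the first (false) and last (true) row or column; since n ∸ 1 reduces to m, the
  -- four wall predicates of the statement are instances of the two `…Wall-exactlyOne` lemmas.
  edge : Bool → ℕ
  edge false = 0
  edge true  = m

  edge<n : ∀ b → edge b < n
  edge<n false = z<s
  edge<n true  = n<1+n m

  onVerticalWall⇔ : ∀ i j q b →
    yPhase (i , j , q) ≡ phase (halfIndex b (edge b) , b) ⇔ (toℕ i ≡ edge b × endPt (d i j) q ≡ vExtreme b)
  onVerticalWall⇔ i j q b =
    ⇔.trans (mk⇔ (phase-injective _ _ (vState-< (i , j , q)) (halfIndex-< b (edge<n b))) (cong phase))
            (⇔.trans halfIndex-pair-≡⇔ (⇔.refl ×-⇔ ⇔.sym (endPt≡vExtreme⇔ (d i j) q b)))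

  onHorizontalWall⇔ : ∀ i j q b →
    xPhase (i , j , q) ≡ phase (halfIndex b (edge b) , b) ⇔ (toℕ j ≡ edge b × endPt (d i j) q ≡ hExtreme b)
  onHorizontalWall⇔ i j q b =
    ⇔.trans (mk⇔ (phase-injective _ _ (hState-< (i , j , q)) (halfIndex-< b (edge<n b))) (cong phase))
            (⇔.trans halfIndex-pair-≡⇔ (⇔.refl ×-⇔ ⇔.sym (endPt≡hExtreme⇔ (d i j) q b)))

  verticalWall-exactlyOne : ∀ b a →
    ExactlyOne (λ j → Σ (Fin n) λ i → toℕ i ≡ edge b × PassesThrough d a i j (vExtreme b))
  verticalWall-exactlyOne b a =
    exactlyOne-by-clock yClock (λ (_ , j , _) → j) _
      (phase-< (halfIndex b (edge b) , b) (halfIndex-< b (edge<n b))) hits⇔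
    where
    hits⇔ : ∀ j → (Σ (Fin n) λ i → toℕ i ≡ edge b × PassesThrough d a i j (vExtreme b)) ⇔
                  (∃[ y ] Reaches a y × yPhase y ≡ phase (halfIndex b (edge b) , b) × proj₁ (proj₂ y) ≡ j)
    hits⇔ j = mk⇔
      (λ (i , i-edge , q , a↝ , end) →
        (i , j , q) , a↝ , Equivalence.from (onVerticalWall⇔ i j q b) (i-edge , end) , refl)
      (λ { ((i , j , q) , a↝ , on , refl) →
        let (i-edge , end) = Equivalence.to (onVerticalWall⇔ i j q b) on in i , i-edge , q , a↝ , end })

  horizontalWall-exactlyOne : ∀ b a →
    ExactlyOne (λ i → Σ (Fin n) λ j → toℕ j ≡ edge b × PassesThrough d a i j (hExtreme b))
  horizontalWall-exactlyOne b a =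
    exactlyOne-by-clock xClock proj₁ _
      (phase-< (halfIndex b (edge b) , b) (halfIndex-< b (edge<n b))) hits⇔
    where
    hits⇔ : ∀ i → (Σ (Fin n) λ j → toℕ j ≡ edge b × PassesThrough d a i j (hExtreme b)) ⇔
                  (∃[ y ] Reaches a y × xPhase y ≡ phase (halfIndex b (edge b) , b) × proj₁ y ≡ i)
    hits⇔ i = mk⇔
      (λ (j , j-edge , q , a↝ , end) →
        (i , j , q) , a↝ , Equivalence.from (onHorizontalWall⇔ i j q b) (j-edge , end) , refl)
      (λ { ((i , j , q) , a↝ , on , refl) →
        let (j-edge , end) = Equivalence.to (onHorizontalWall⇔ i j q b) on in j , j-edge , q , a↝ , end })

  topArc : Fin n → Arc n
  topArc j = fz , j , arcTo (d fz j) N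

  top-hit⇒topArc : ∀ i j q → toℕ i ≡ 0 → endPt (d i j) q ≡ N → (i , j , q) ≡ topArc j
  top-hit⇒topArc fz j q _ end = cong (λ q → fz , j , q) (begin
    q                                 ≡⟨ arcTo-endPt (d fz j) q ⟨
    arcTo (d fz j) (endPt (d fz j) q) ≡⟨ cong (arcTo (d fz j)) end ⟩
    arcTo (d fz j) N                  ∎)
    where open ≡-Reasoning

  numRings : NumRings d n
  numRings = topArc , covers , distinct
    where
    covers : ∀ a → ∃[ r ] SameRing d (topArc r) a
    covers a with proj₁ (verticalWall-exactlyOne false a)
    ... | j , i , i≡0 , q , a↝ , end =
      j , reaches-sym (subst (Reaches a) (top-hit⇒topArc i j q i≡0 end) a↝)
    distinct : ∀ r r' → SameRing d (topArc r) (topArc r') → r ≡ r'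
    distinct r r' r↝r' = proj₂ (verticalWall-exactlyOne false (topArc r)) r r'
      (fz , refl , _ , (0 , refl) , endPt-arcTo (d fz r) N)
      (fz , refl , _ , r↝r' , endPt-arcTo (d fz r') N)

  ringArcCount : ∀ a → RingArcCount d a (4 * n)
  ringArcCount a = subst (RingArcCount d a) period≡4n
    (z<s , iter-period a , iter-aperiodic yClock a)
    where
    period≡4n : period ≡ 4 * n
    period≡4n = trans (cong₂ _+_ (double≡2* n) (double≡2* n)) (sym (*-distribʳ-+ n 2 2))

mainTheorem3 : (n : ℕ) → 1 ≤ n → (d : DirAssign n) →
    (∀ i j i' j' → Adjacent (i , j) (i' , j') → d i j ≢ d i' j') →
    NumRings d n ×
    (∀ (a : Arc n) →
      RingArcCount d a (4 * n) ×
      ExactlyOne (HitsTop d a) × ExactlyOne (HitsBottom d a) ×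
      ExactlyOne (HitsLeft d a) × ExactlyOne (HitsRight d a))
mainTheorem3 (suc m) _ d proper = numRings , λ a →
  ringArcCount a ,
  verticalWall-exactlyOne false a , verticalWall-exactlyOne true a ,
  horizontalWall-exactlyOne false a , horizontalWall-exactlyOne true a
  where open Grid m d proper
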